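{- The Cabello–Pérez-Lantero algorithm $\mathcal{CP}$ is monotonic: for any two finite streams of intervals $A, B$, we have $|\mathcal{CP}(A)| \le |\mathcal{CP}(AB)|$, where $AB$ denotes the concatenation of $A$ followed by $B$.
   Context: For an interval $I=[a,b]$ write $\mathrm{left}(I)=a$, $\mathrm{right}(I)=b$. The streaming algorithm $\mathcal{CP}$ maintains a partition $\mathcal{R}$ of the real line into intervals called regions, initially $\mathcal{R}=\{\mathbb{R}\}$, and for each region $R$ two stored intervals $\mathrm{leftmost}(R)$ and $\mathrm{rightmost}(R)$ (initially $\mathrm{leftmost}(\mathbb{R})=\mathrm{rightmost}(\mathbb{R})=\mathbb{R}$). When an interval $I$ arrives: if $I$ is not contained in a single region, it is ignored. Otherwise let $R$ be the region containing $I$. If $I\cap \mathrm{leftmost}(R)\cap\mathrm{rightmost}(R)\neq\emptyset$, then: if $\mathrm{right}(I)\le \mathrm{right}(\mathrm{leftmost}(R))$ set $\mathrm{leftmost}(R)\leftarrow I$, and if $\mathrm{left}(I)\ge\mathrm{left}(\mathrm{rightmost}(R))$ set $\mathrm{rightmost}(R)\leftarrow I$. Otherwise, if $\mathrm{right}(I)\le \mathrm{left}(\mathrm{rightmost}(R))$, replace $R$ by two regions obtained by splitting $R$ at the point $\mathrm{right}(I)$: $R_1$ (the part of $R$ up to and including $\mathrm{right}(I)$) with $\mathrm{leftmost}(R_1)=\mathrm{rightmost}(R_1)=I$, and $R_2$ (the rest of $R$) with $\mathrm{leftmost}(R_2)=\mathrm{rightmost}(R_2)=\mathrm{rightmost}(R)$;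 else replace $R$ by $R_1$ (the part of $R$ strictly left of $\mathrm{left}(I)$) with $\mathrm{leftmost}(R_1)=\mathrm{rightmost}(R_1)=\mathrm{leftmost}(R)$, and $R_2$ (the rest of $R$) with $\mathrm{leftmost}(R_2)=\mathrm{rightmost}(R_2)=I$. The output is $\{\mathrm{leftmost}(R): R\in\mathcal{R}\}$. For a stream $S$, $|\mathcal{CP}(S)|$ denotes the size of the output of $\mathcal{CP}$ after processing $S$, which equals the number of regions $|\mathcal{R}|$.
   Formalization: The intervals in the streams $A, B$ have rational endpoints rather than real ones. -}

module Defs where

open import Data.Bool using (Bool; true; false; if_then_else_; _∧_; not)
open import Data.List using (List; []; _∷_; _++_; foldl; concatMap; length)
open import Data.Nat using (ℕ)
open import Data.Rational using (ℚ; _≤_; _≤ᵇ_)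

-- Endpoints of input intervals are rationals.
-- An input interval [a,b] with a ≤ b (closed, bounded).
record Interval : Set where
  constructor [_,_]⟨_⟩
  field
    left  : ℚ
    right : ℚ
    l≤r   : left ≤ right
open Interval public

_<ᵇ_ : ℚ → ℚ → Bool
p <ᵇ q = not (q ≤ᵇ p)

-- Stored intervals: either the whole line ℝ or an input interval.
data Stored : Set where
  whole : Stored
  ival  : Interval → Stored

data LBound : Set where
  -∞   : LBound
  cl⟨_ : ℚ → LBound
  op⟨_ : ℚ → LBound

data UBound : Set where
  +∞   : UBound
  _⟩cl : ℚ → UBound
  _⟩op : ℚ → UBound

record Region : Set where
  constructor region
  field
    lo        : LBound
    hi        : UBound
    leftmost  : Stored
    rightmost : Stored
open Region public

aboveLo : LBound → ℚ → Bool
aboveLo -∞       p = true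
aboveLo (cl⟨ x)  p = x ≤ᵇ p
aboveLo (op⟨ x)  p = x <ᵇ p

belowHi : UBound → ℚ → Bool
belowHi +∞      p = true
belowHi (x ⟩cl) p = p ≤ᵇ x
belowHi (x ⟩op) p = p <ᵇ x

containedIn : Interval → Region → Bool
containedIn I R = aboveLo (lo R) (left I) ∧ belowHi (hi R) (right I)

rightGe : Stored → ℚ → Bool
rightGe whole    p = true
rightGe (ival J) p = p ≤ᵇ right J

leftLe : Stored → ℚ → Bool
leftLe whole    p = true
leftLe (ival J) p = left J ≤ᵇ p

rightLeLeft : Interval → Stored → Bool
rightLeLeft I whole    = false
rightLeLeft I (ival J) = right I ≤ᵇ left J

leftGeLeft : Interval → Stored → Bool
leftGeLeft I J = leftLe J (left I)

rightLeRight : Interval → Stored → Bool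
rightLeRight I J = rightGe J (right I)

-- Intersection of closed intervals I, L, M is nonempty iff every left
-- endpoint is ≤ every right endpoint (one-dimensional Helly property).
-- left(J) ≤ right(K) for stored intervals
leftLeRight : Stored → Stored → Bool
leftLeRight whole    K = true
leftLeRight (ival J) K = rightGe K (left J)

meets3 : Interval → Stored → Stored → Bool
meets3 I L M =
  leftLeRight (ival I) (ival I) ∧ leftLeRight (ival I) L ∧ leftLeRight (ival I) M ∧
  leftLeRight L (ival I) ∧ leftLeRight L L ∧ leftLeRight L M ∧
  leftLeRight M (ival I) ∧ leftLeRight M L ∧ leftLeRight M M

update : Interval → Region → List Region
update I (region lo hi L M) =
  if meets3 I L M
  then region lo hi (if rightLeRight I L then ival I else L)
                    (if leftGeLeft I M then ival I else M) ∷ []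
  else (if rightLeLeft I M
        then region lo (right I ⟩cl) (ival I) (ival I)
             ∷ region (op⟨ right I) hi M M ∷ []
        else region lo (left I ⟩op) L L
             ∷ region (cl⟨ left I) hi (ival I) (ival I) ∷ [])

-- One step of CP: the (unique, since 𝓡 is a partition) region containing I
-- is updated; if no region contains I, I is ignored.
step : List Region → Interval → List Region
step 𝓡 I = concatMap (λ R → if containedIn I R then update I R else R ∷ []) 𝓡

initial : List Region
initial = region -∞ +∞ whole whole ∷ []

CP : List Interval → List Region
CP S = foldl step initial S

∣CP_∣ : List Interval → ℕ
∣CP S ∣ = length (CP S)

{-# OPTIONS --safe #-}
module Submission where

-- Each step of CP replaces every region by a nonempty list of regions (one region,
-- or two after a split), so the number of regions never decreases along a stream.

open import Defs
open import Data.Bool using (true; false; if_then_else_)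
open import Data.List using (List; []; _∷_; _++_; foldl; length; concatMap)
open import Data.List.Properties using (length-++; foldl-++)
open import Data.Nat using (ℕ; _≤_; _+_; s≤s; z≤n)
open import Data.Nat.Properties using (≤-refl; ≤-trans; +-mono-≤; module ≤-Reasoning)
open import Level using (Level)
open import Relation.Binary.PropositionalEquality using (cong; sym)

private
  variable
    a b : Level
    A : Set a
    B : Set b

length-≤-concatMap : (f : A → List B) → (∀ x → 1 ≤ length (f x)) →
                     ∀ xs → length xs ≤ length (concatMap f xs)
length-≤-concatMap f f-nonempty []       = z≤n
length-≤-concatMap f f-nonempty (x ∷ xs) = begin
  1 + length xs                          ≤⟨ +-mono-≤ (f-nonempty x) (length-≤-concatMap f f-nonempty xs) ⟩
  length (f x) + length (concatMap f xs) ≡⟨ sym (length-++ (f x)) ⟩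
  length (concatMap f (x ∷ xs))          ∎
  where open ≤-Reasoning

foldl-inflationary : (μ : A → ℕ) (f : A → B → A) → (∀ x y → μ x ≤ μ (f x y)) →
                     ∀ x ys → μ x ≤ μ (foldl f x ys)
foldl-inflationary μ f f-inflationary x []       = ≤-refl
foldl-inflationary μ f f-inflationary x (y ∷ ys) =
  ≤-trans (f-inflationary x y) (foldl-inflationary μ f f-inflationary (f x y) ys)

update-nonempty : ∀ I R → 1 ≤ length (update I R)
update-nonempty I (region lo hi L M) with meets3 I L M | rightLeLeft I M
... | true  | _     = s≤s z≤n
... | false | true  = s≤s z≤n
... | false | false = s≤s z≤n

length-≤-step : ∀ 𝓡 I → length 𝓡 ≤ length (step 𝓡 I)
length-≤-step 𝓡 I = length-≤-concatMap _ step-nonempty 𝓡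
  where
  step-nonempty : ∀ R → 1 ≤ length (if containedIn I R then update I R else R ∷ [])
  step-nonempty R with containedIn I R
  ... | true  = update-nonempty I R
  ... | false = s≤s z≤n

lemma1 : (A B : List Interval) → ∣CP A ∣ ≤ ∣CP A ++ B ∣
lemma1 A B = begin
  length (CP A)                ≤⟨ foldl-inflationary length step length-≤-step (CP A) B ⟩
  length (foldl step (CP A) B) ≡⟨ cong length (sym (foldl-++ step initial A B)) ⟩
  ∣CP A ++ B ∣                 ∎
  where open ≤-Reasoning
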